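{- Let $D$ be a digraph and let $\mathcal{Q}$ be a partial path decomposition for $D$. If the digraph $D-\mathcal{Q}$ is consistent, then $D$ has a perfect path decomposition $\mathcal{P}$ with $\mathcal{Q}\subseteq\mathcal{P}$.
   Context: A digraph has no loops and, between two distinct vertices, at most one edge in each direction. Paths are directed paths (distinct vertices); for a path $P$, $\ell(P)$ and $r(P)$ denote its first and last vertex. A path family is a collection of pairwise edge-disjoint paths; for a path family $\mathcal{Q}$, $D-\mathcal{Q}$ is the digraph obtained from $D$ by deleting all edges of paths in $\mathcal{Q}$. For $v\in V(D)$, $\mathrm{ex}^+_D(v)=\max\{d^+_D(v)-d^-_D(v),0\}$, $\mathrm{ex}^-_D(v)=\max\{d^-_D(v)-d^+_D(v),0\}$, and $\mathrm{ex}(D)=\sum_v \mathrm{ex}^+_D(v)$. A path decomposition of $D$ is a path family whose edges are exactly $E(D)$; it is perfect if it consists of exactly $\mathrm{ex}(D)$ paths, and $D$ is consistent if it has a perfect path decomposition. A path family $\mathcal{Q}$ in $D$ is a partial path decomposition for $D$ if for every $v\in V(D)$, $|\{Q\in\mathcal{Q}:\ell(Q)=v\}|\leq \mathrm{ex}^+_D(v)$ and $|\{Q\in\mathcal{Q}:r(Q)=v\}|\leq \mathrm{ex}^-_D(v)$. -}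

module Defs where

open import Data.Nat using (ℕ; _∸_; _≤_)
open import Data.Bool using (Bool; true; false; _∧_; not; if_then_else_)
open import Data.Fin using (Fin)
open import Data.Fin.Properties using () renaming (_≟_ to _≟ᶠ_)
open import Data.List using (List; []; _∷_; map; concatMap; length; allFin)
open import Data.Nat.ListAction using (sum)
open import Data.List.Relation.Unary.All using (All)
open import Data.List.Relation.Unary.AllPairs using (AllPairs)
open import Data.List.Relation.Unary.Unique.Propositional using (Unique)
open import Data.List.Membership.Propositional using (_∈_)
open import Data.Product using (Σ; _×_; _,_; proj₁; proj₂)
open import Data.Product.Properties using (≡-dec)
open import Data.Empty using (⊥)
open import Relation.Nullary using (¬_; does)
open import Relation.Binary.PropositionalEquality using (_≡_)
import Data.List.Membership.DecPropositional as DecMem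

-- A digraph on vertex set Fin n: adjacency relation, no loops.
-- (At most one edge in each direction is automatic for a relation.)
record Digraph (n : ℕ) : Set where
  field
    adj      : Fin n → Fin n → Bool
    loopless : ∀ v → adj v v ≡ false
open Digraph public

Edge : ℕ → Set
Edge n = Fin n × Fin n

Walk : ℕ → Set
Walk n = Fin n × List (Fin n)

vertices : ∀ {n} → Walk n → List (Fin n)
vertices (v , ws) = v ∷ ws

edgesFrom : ∀ {n} → Fin n → List (Fin n) → List (Edge n)
edgesFrom v []       = []
edgesFrom v (w ∷ ws) = (v , w) ∷ edgesFrom w ws

edges : ∀ {n} → Walk n → List (Edge n)
edges (v , ws) = edgesFrom v ws

lastFrom : ∀ {n} → Fin n → List (Fin n) → Fin n
lastFrom v []       = v
lastFrom v (w ∷ ws) = lastFrom w ws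

ℓ : ∀ {n} → Walk n → Fin n
ℓ (v , ws) = v

r : ∀ {n} → Walk n → Fin n
r (v , ws) = lastFrom v ws

IsPath : ∀ {n} → Digraph n → Walk n → Set
IsPath D P = ¬ (proj₂ P ≡ [])
           × Unique (vertices P)
           × All (λ e → adj D (proj₁ e) (proj₂ e) ≡ true) (edges P)

EdgeDisjoint : ∀ {n} → Walk n → Walk n → Set
EdgeDisjoint P Q = ∀ e → e ∈ edges P → e ∈ edges Q → ⊥

IsPathFamily : ∀ {n} → Digraph n → List (Walk n) → Set
IsPathFamily D 𝒬 = All (IsPath D) 𝒬 × AllPairs EdgeDisjoint 𝒬

familyEdges : ∀ {n} → List (Walk n) → List (Edge n)
familyEdges 𝒬 = concatMap edges 𝒬

_∈ᵉ?_ : ∀ {n} (e : Edge n) (es : List (Edge n)) → Bool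
_∈ᵉ?_ {n} e es = does (DecMem._∈?_ (≡-dec _≟ᶠ_ _≟ᶠ_) e es)

_─_ : ∀ {n} → Digraph n → List (Walk n) → Digraph n
adj (D ─ 𝒬) u v = adj D u v ∧ not ((u , v) ∈ᵉ? familyEdges 𝒬)
loopless (D ─ 𝒬) v rewrite loopless D v = _≡_.refl

b2n : Bool → ℕ
b2n b = if b then 1 else 0

outdeg indeg : ∀ {n} → Digraph n → Fin n → ℕ
outdeg {n} D v = sum (map (λ w → b2n (adj D v w)) (allFin n))
indeg  {n} D v = sum (map (λ w → b2n (adj D w v)) (allFin n))

-- ex⁺ and ex⁻ (truncated subtraction = max{·,0})
ex⁺ ex⁻ : ∀ {n} → Digraph n → Fin n → ℕ
ex⁺ D v = outdeg D v ∸ indeg D v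
ex⁻ D v = indeg D v ∸ outdeg D v

ex : ∀ {n} → Digraph n → ℕ
ex {n} D = sum (map (ex⁺ D) (allFin n))

IsPathDecomposition : ∀ {n} → Digraph n → List (Walk n) → Set
IsPathDecomposition D 𝒫 =
  IsPathFamily D 𝒫 ×
  (∀ u v → (adj D u v ≡ true → (u , v) ∈ familyEdges 𝒫)
         × ((u , v) ∈ familyEdges 𝒫 → adj D u v ≡ true))

IsPerfectPathDecomposition : ∀ {n} → Digraph n → List (Walk n) → Set
IsPerfectPathDecomposition D 𝒫 = IsPathDecomposition D 𝒫 × length 𝒫 ≡ ex D

Consistent : ∀ {n} → Digraph n → Set
Consistent {n} D = Σ (List (Walk n)) (IsPerfectPathDecomposition D)

#startingAt #endingAt : ∀ {n} → List (Walk n) → Fin n → ℕ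
#startingAt 𝒬 v = sum (map (λ P → b2n (does (ℓ P ≟ᶠ v))) 𝒬)
#endingAt   𝒬 v = sum (map (λ P → b2n (does (r P ≟ᶠ v))) 𝒬)

IsPartialPathDecomposition : ∀ {n} → Digraph n → List (Walk n) → Set
IsPartialPathDecomposition D 𝒬 =
  IsPathFamily D 𝒬 ×
  (∀ v → #startingAt 𝒬 v ≤ ex⁺ D v × #endingAt 𝒬 v ≤ ex⁻ D v)

{-# OPTIONS --safe #-}
module Submission where

-- Take 𝒫 = 𝒬 ++ 𝒫′ for a perfect path decomposition 𝒫′ of D ─ 𝒬.  As the
-- edges of D are those of 𝒬 and those of D ─ 𝒬, it is a path decomposition
-- of D, and it is perfect iff
-- ex D = ex (D ─ 𝒬) + |𝒬|.  This is proved vertex by vertex: a path adds 1 to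
-- outdeg − indeg at its start, subtracts 1 at its end and changes nothing
-- elsewhere, and the bounds in the definition of a partial path decomposition
-- say that no truncation happens, so that
-- ex⁺_D(v) = ex⁺_{D ─ 𝒬}(v) + #{Q ∈ 𝒬 : ℓ(Q) = v}.

open import Defs
open import Data.Bool using (true; false; _∧_; _∨_; not)
open import Data.Fin using (Fin; zero; suc)
open import Data.Fin.Properties using () renaming (_≟_ to _≟ᶠ_)
open import Data.List using (List; []; _∷_; _++_; map; length; tabulate; allFin)
open import Data.List.Membership.Propositional using (_∈_; _∉_; lose; find)
open import Data.List.Membership.Propositional.Properties
  using (∈-++⁺ˡ; ∈-++⁺ʳ; ∈-++⁻; ∈-concatMap⁺; ∈-concatMap⁻)
import Data.List.Membership.DecPropositional as DecMembership
open import Data.List.Properties using (map-++; map-cong; length-++; concatMap-++)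
open import Data.List.Relation.Binary.Subset.Propositional using (_⊆_)
open import Data.List.Relation.Unary.All as All using (All; []; _∷_)
open import Data.List.Relation.Unary.All.Properties as Allₚ using (All¬⇒¬Any)
open import Data.List.Relation.Unary.AllPairs as AllPairs using (AllPairs; []; _∷_)
import Data.List.Relation.Unary.AllPairs.Properties as AllPairsₚ
open import Data.List.Relation.Unary.Any using (here; there)
open import Data.List.Relation.Unary.Unique.Propositional using (Unique)
open import Data.List.Relation.Unary.Unique.Propositional.Properties using (concat⁺)
open import Data.Nat using (ℕ; zero; suc; _+_; _*_; _∸_; _≤_)
open import Data.Nat.ListAction using (sum)
open import Data.Nat.ListAction.Properties using (sum-++)
open import Data.Nat.Properties
  using ( +-identityʳ; *-identityˡ; *-identityʳ; +-assoc; +-comm; +-cancelʳ-≡; ≤-total; m≤m+n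
        ; 0∸n≡0; m≤n⇒m∸n≡0; m+n∸m≡n; m∸n+n≡m; +-commutativeSemigroup; +-*-semiring)
open import Data.Product using (Σ; _×_; _,_; proj₁; proj₂; uncurry)
open import Data.Product.Properties using (≡-dec; ,-injective)
open import Data.Sum as Sum using (_⊎_; inj₁; inj₂)
open import Level using (Level)
open import Function using (id; _⇔_; mk⇔)
open import Relation.Binary.Definitions using (DecidableEquality)
open import Relation.Binary.PropositionalEquality
open import Relation.Nullary using (¬_; Dec; yes; no; does; _×-dec_; contradiction)
open import Relation.Nullary.Decidable using (dec-false; does-⇔)
open import Algebra.Properties.CommutativeSemigroup +-commutativeSemigroup
  using (interchange)
open import Algebra.Properties.Semiring.Sum +-*-semiring
  using (sum-syntax; sum-cong-≗; sum-replicate-zero; ∑-distrib-+; *-distribˡ-sum; *-distribʳ-sum)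
open ≡-Reasoning

private
  variable
    a : Level
    A B : Set a

m+[n∸m]≡n+[m∸n] : ∀ m n → m + (n ∸ m) ≡ n + (m ∸ n)
m+[n∸m]≡n+[m∸n] zero    zero    = refl
m+[n∸m]≡n+[m∸n] zero    (suc n) = sym (+-identityʳ (suc n))
m+[n∸m]≡n+[m∸n] (suc m) zero    = +-identityʳ (suc m)
m+[n∸m]≡n+[m∸n] (suc m) (suc n) = cong suc (m+[n∸m]≡n+[m∸n] m n)

m∸n≡0⊎n∸m≡0 : ∀ m n → m ∸ n ≡ 0 ⊎ n ∸ m ≡ 0
m∸n≡0⊎n∸m≡0 m n = Sum.map m≤n⇒m∸n≡0 m≤n⇒m∸n≡0 (≤-total m n)

∸-unique : ∀ {m n p q} → m + q ≡ n + p → p ≡ 0 ⊎ q ≡ 0 → p ≡ m ∸ n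
∸-unique {m} {n} {q = q} eq (inj₁ refl) =
  sym (m≤n⇒m∸n≡0 (subst (m ≤_) (trans eq (+-identityʳ n)) (m≤m+n m q)))
∸-unique {m} {n} {p} eq (inj₂ refl) =
  sym (trans (cong (_∸ n) (trans (sym (+-identityʳ m)) eq)) (m+n∸m≡n n p))

-- The shape of ex⁺ at a vertex: o, i are the degrees in D ─ 𝒬, a, b count
-- the edges of 𝒬 leaving and entering it, s, e the paths of 𝒬 starting and
-- ending there.
∸-+-excess : ∀ o i {a b s e} → a + e ≡ b + s →
  s ≤ (o + a) ∸ (i + b) → e ≤ (i + b) ∸ (o + a) → (o + a) ∸ (i + b) ≡ o ∸ i + s
∸-+-excess o i {a} {b} {s} {e} a+e≡b+s s≤X e≤Y = begin
  X          ≡⟨ sym (m∸n+n≡m s≤X) ⟩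
  X ∸ s + s  ≡⟨ cong (_+ s) (∸-unique balanced one-side-zero) ⟩
  o ∸ i + s  ∎
  where
  X = (o + a) ∸ (i + b)
  Y = (i + b) ∸ (o + a)

  ∸-zero : ∀ k {m} → m ≡ 0 → m ∸ k ≡ 0
  ∸-zero k refl = 0∸n≡0 k

  one-side-zero : X ∸ s ≡ 0 ⊎ Y ∸ e ≡ 0
  one-side-zero = Sum.map (∸-zero s) (∸-zero e) (m∸n≡0⊎n∸m≡0 (o + a) (i + b))

  balanced : o + (Y ∸ e) ≡ i + (X ∸ s)
  balanced = +-cancelʳ-≡ (a + e) _ _ (begin
    o + (Y ∸ e) + (a + e)  ≡⟨ interchange o (Y ∸ e) a e ⟩
    (o + a) + (Y ∸ e + e)  ≡⟨ cong ((o + a) +_) (m∸n+n≡m e≤Y) ⟩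
    (o + a) + Y            ≡⟨ m+[n∸m]≡n+[m∸n] (o + a) (i + b) ⟩
    (i + b) + X            ≡⟨ cong ((i + b) +_) (sym (m∸n+n≡m s≤X)) ⟩
    (i + b) + (X ∸ s + s)  ≡⟨ interchange i b (X ∸ s) s ⟩
    i + (X ∸ s) + (b + s)  ≡⟨ cong (i + (X ∸ s) +_) (sym a+e≡b+s) ⟩
    i + (X ∸ s) + (a + e)  ∎)

𝟙 : Dec A → ℕ
𝟙 a? = b2n (does a?)

𝟙-cong : A ⇔ B → (a? : Dec A) (b? : Dec B) → 𝟙 a? ≡ 𝟙 b?
𝟙-cong A⇔B a? b? = cong b2n (does-⇔ A⇔B a? b?)

b2n-∧ : ∀ x y → b2n (x ∧ y) ≡ b2n x * b2n y
b2n-∧ false y = refl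
b2n-∧ true  y = sym (+-identityʳ (b2n y))

b2n-∨ : ∀ x y → (x ≡ true → y ≡ false) → b2n (x ∨ y) ≡ b2n x + b2n y
b2n-∨ false y _ = refl
b2n-∨ true  y x⇒¬y rewrite x⇒¬y refl = refl

b2n-∧-not : ∀ x (a? : Dec A) → (A → x ≡ true) → b2n x ≡ b2n (x ∧ not (does a?)) + 𝟙 a?
b2n-∧-not true  (yes _) _     = refl
b2n-∧-not false (yes a) a⇒x   = contradiction (a⇒x a) λ ()
b2n-∧-not true  (no _)  _     = refl
b2n-∧-not false (no _)  _     = refl

∧-not-does⁻ : ∀ x (a? : Dec A) → x ∧ not (does a?) ≡ true → x ≡ true × ¬ A
∧-not-does⁻ true (no ¬a) _ = refl , ¬a

∧-not-does⁺ : ∀ {x} (a? : Dec A) → x ≡ true → ¬ A → x ∧ not (does a?) ≡ true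
∧-not-does⁺ (yes a) _    ¬a = contradiction a ¬a
∧-not-does⁺ (no _)  refl _  = refl

sum-map-++ : (f : A → ℕ) (xs ys : List A) → sum (map f (xs ++ ys)) ≡ sum (map f xs) + sum (map f ys)
sum-map-++ f xs ys = trans (cong sum (map-++ f xs ys)) (sum-++ (map f xs) (map f ys))

sum-map-tabulate : ∀ {n} (f : A → ℕ) (g : Fin n → A) → sum (map f (tabulate g)) ≡ ∑[ i < n ] f (g i)
sum-map-tabulate {n = zero}  f g = refl
sum-map-tabulate {n = suc n} f g = cong (f (g zero) +_) (sum-map-tabulate f (λ i → g (suc i)))

sum-map-allFin : ∀ {n} (f : Fin n → ℕ) → sum (map f (allFin n)) ≡ ∑[ i < n ] f i
sum-map-allFin f = sum-map-tabulate f id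

∑-𝟙-≟ : ∀ {n} (j : Fin n) → ∑[ i < n ] 𝟙 (i ≟ᶠ j) ≡ 1
∑-𝟙-≟ {suc n} zero    = cong suc (sum-replicate-zero n)
∑-𝟙-≟ {suc n} (suc j) = ∑-𝟙-≟ j

𝟙-≟ᶠ-sym : ∀ {n} (i j : Fin n) → 𝟙 (i ≟ᶠ j) ≡ 𝟙 (j ≟ᶠ i)
𝟙-≟ᶠ-sym i j = 𝟙-cong (mk⇔ sym sym) (i ≟ᶠ j) (j ≟ᶠ i)

module _ (_≟_ : DecidableEquality A) where
  open DecMembership _≟_ using (_∈?_)

  𝟙-∈-∷ : ∀ {x xs} y → x ∉ xs → 𝟙 (y ∈? (x ∷ xs)) ≡ 𝟙 (y ≟ x) + 𝟙 (y ∈? xs)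
  𝟙-∈-∷ {x} {xs} y x∉xs = b2n-∨ (does (y ≟ x)) (does (y ∈? xs)) y≡x⇒y∉xs
    where
    y≡x⇒y∉xs : does (y ≟ x) ≡ true → does (y ∈? xs) ≡ false
    y≡x⇒y∉xs _ with y ≟ x
    ... | yes refl = dec-false (y ∈? xs) x∉xs

  ∑-𝟙-∈ : ∀ {m} (f : Fin m → A) {xs} → Unique xs →
    ∑[ i < m ] 𝟙 (f i ∈? xs) ≡ sum (map (λ x → ∑[ i < m ] 𝟙 (f i ≟ x)) xs)
  ∑-𝟙-∈ {m} f []                 = sum-replicate-zero m
  ∑-𝟙-∈ {m} f {x ∷ xs} (x≢xs ∷ xs!) = begin
    ∑[ i < m ] 𝟙 (f i ∈? (x ∷ xs))                       ≡⟨ sum-cong-≗ (λ i → 𝟙-∈-∷ (f i) (All¬⇒¬Any x≢xs)) ⟩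
    ∑[ i < m ] (𝟙 (f i ≟ x) + 𝟙 (f i ∈? xs))            ≡⟨ ∑-distrib-+ (λ i → 𝟙 (f i ≟ x)) (λ i → 𝟙 (f i ∈? xs)) ⟩
    ∑[ i < m ] 𝟙 (f i ≟ x) + ∑[ i < m ] 𝟙 (f i ∈? xs)  ≡⟨ cong (_ +_) (∑-𝟙-∈ f xs!) ⟩
    sum (map (λ x → ∑[ i < m ] 𝟙 (f i ≟ x)) (x ∷ xs))    ∎

module _ {n : ℕ} where
  -- The decision procedure behind _∈ᵉ?_, so that adj (D ─ 𝒬) u v unfolds to
  -- adj D u v ∧ not (does ((u , v) ∈? familyEdges 𝒬)).
  _≟ᵉ_ : DecidableEquality (Edge n)
  _≟ᵉ_ = ≡-dec _≟ᶠ_ _≟ᶠ_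

  open DecMembership _≟ᵉ_ using (_∈?_)

  #leaving #entering : Fin n → List (Edge n) → ℕ
  #leaving  v es = sum (map (λ e → 𝟙 (proj₁ e ≟ᶠ v)) es)
  #entering v es = sum (map (λ e → 𝟙 (proj₂ e ≟ᶠ v)) es)

  𝟙-,-≟ᵉ : (x y u v : Fin n) → 𝟙 ((x , y) ≟ᵉ (u , v)) ≡ 𝟙 (x ≟ᶠ u) * 𝟙 (y ≟ᶠ v)
  𝟙-,-≟ᵉ x y u v = trans (𝟙-cong (mk⇔ ,-injective (uncurry (cong₂ _,_))) ((x , y) ≟ᵉ (u , v)) ((x ≟ᶠ u) ×-dec (y ≟ᶠ v)))
                        (b2n-∧ (does (x ≟ᶠ u)) (does (y ≟ᶠ v)))

  ∑-𝟙-∈-leaving : ∀ v {es} → Unique es → ∑[ w < n ] 𝟙 ((v , w) ∈? es) ≡ #leaving v es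
  ∑-𝟙-∈-leaving v {es} es! = begin
    ∑[ w < n ] 𝟙 ((v , w) ∈? es)                          ≡⟨ ∑-𝟙-∈ _≟ᵉ_ (v ,_) es! ⟩
    sum (map (λ e → ∑[ w < n ] 𝟙 ((v , w) ≟ᵉ e)) es)      ≡⟨ cong sum (map-cong leaving-once es) ⟩
    #leaving v es                                          ∎
    where
    leaving-once : ∀ e → ∑[ w < n ] 𝟙 ((v , w) ≟ᵉ e) ≡ 𝟙 (proj₁ e ≟ᶠ v)
    leaving-once (x , y) = begin
      ∑[ w < n ] 𝟙 ((v , w) ≟ᵉ (x , y))          ≡⟨ sum-cong-≗ (λ w → 𝟙-,-≟ᵉ v w x y) ⟩
      ∑[ w < n ] (𝟙 (v ≟ᶠ x) * 𝟙 (w ≟ᶠ y))      ≡⟨ sym (*-distribˡ-sum (𝟙 (v ≟ᶠ x)) (λ w → 𝟙 (w ≟ᶠ y))) ⟩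
      𝟙 (v ≟ᶠ x) * (∑[ w < n ] 𝟙 (w ≟ᶠ y))      ≡⟨ cong (𝟙 (v ≟ᶠ x) *_) (∑-𝟙-≟ y) ⟩
      𝟙 (v ≟ᶠ x) * 1                             ≡⟨ *-identityʳ _ ⟩
      𝟙 (v ≟ᶠ x)                                 ≡⟨ 𝟙-≟ᶠ-sym v x ⟩
      𝟙 (x ≟ᶠ v)                                 ∎

  ∑-𝟙-∈-entering : ∀ v {es} → Unique es → ∑[ w < n ] 𝟙 ((w , v) ∈? es) ≡ #entering v es
  ∑-𝟙-∈-entering v {es} es! = begin
    ∑[ w < n ] 𝟙 ((w , v) ∈? es)                          ≡⟨ ∑-𝟙-∈ _≟ᵉ_ (_, v) es! ⟩
    sum (map (λ e → ∑[ w < n ] 𝟙 ((w , v) ≟ᵉ e)) es)      ≡⟨ cong sum (map-cong entering-once es) ⟩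
    #entering v es                                         ∎
    where
    entering-once : ∀ e → ∑[ w < n ] 𝟙 ((w , v) ≟ᵉ e) ≡ 𝟙 (proj₂ e ≟ᶠ v)
    entering-once (x , y) = begin
      ∑[ w < n ] 𝟙 ((w , v) ≟ᵉ (x , y))          ≡⟨ sum-cong-≗ (λ w → 𝟙-,-≟ᵉ w v x y) ⟩
      ∑[ w < n ] (𝟙 (w ≟ᶠ x) * 𝟙 (v ≟ᶠ y))      ≡⟨ sym (*-distribʳ-sum (𝟙 (v ≟ᶠ y)) (λ w → 𝟙 (w ≟ᶠ x))) ⟩
      (∑[ w < n ] 𝟙 (w ≟ᶠ x)) * 𝟙 (v ≟ᶠ y)      ≡⟨ cong (_* 𝟙 (v ≟ᶠ y)) (∑-𝟙-≟ x) ⟩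
      1 * 𝟙 (v ≟ᶠ y)                             ≡⟨ *-identityˡ _ ⟩
      𝟙 (v ≟ᶠ y)                                 ≡⟨ 𝟙-≟ᶠ-sym v y ⟩
      𝟙 (y ≟ᶠ v)                                 ∎

  edgesFrom-balance : ∀ u ws v →
    #leaving v (edgesFrom u ws) + 𝟙 (lastFrom u ws ≟ᶠ v) ≡ #entering v (edgesFrom u ws) + 𝟙 (u ≟ᶠ v)
  edgesFrom-balance u []       v = refl
  edgesFrom-balance u (w ∷ ws) v = begin
    𝟙 (u ≟ᶠ v) + L + t              ≡⟨ +-assoc (𝟙 (u ≟ᶠ v)) L t ⟩
    𝟙 (u ≟ᶠ v) + (L + t)            ≡⟨ cong (𝟙 (u ≟ᶠ v) +_) (edgesFrom-balance w ws v) ⟩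
    𝟙 (u ≟ᶠ v) + (E + 𝟙 (w ≟ᶠ v))  ≡⟨ +-comm (𝟙 (u ≟ᶠ v)) _ ⟩
    E + 𝟙 (w ≟ᶠ v) + 𝟙 (u ≟ᶠ v)    ≡⟨ cong (_+ 𝟙 (u ≟ᶠ v)) (+-comm E _) ⟩
    𝟙 (w ≟ᶠ v) + E + 𝟙 (u ≟ᶠ v)    ∎
    where
    L = #leaving v (edgesFrom w ws)
    E = #entering v (edgesFrom w ws)
    t = 𝟙 (lastFrom w ws ≟ᶠ v)

  familyEdges-balance : ∀ (𝒬 : List (Walk n)) v →
    #leaving v (familyEdges 𝒬) + #endingAt 𝒬 v ≡ #entering v (familyEdges 𝒬) + #startingAt 𝒬 v
  familyEdges-balance []               v = refl
  familyEdges-balance (P@(u , ws) ∷ 𝒬) v = begin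
    #leaving v (edges P ++ familyEdges 𝒬) + (𝟙 (r P ≟ᶠ v) + #endingAt 𝒬 v)
      ≡⟨ cong (_+ (𝟙 (r P ≟ᶠ v) + #endingAt 𝒬 v)) (sum-map-++ _ (edges P) (familyEdges 𝒬)) ⟩
    (Lᴾ + L𝒬) + (𝟙 (r P ≟ᶠ v) + #endingAt 𝒬 v)
      ≡⟨ interchange Lᴾ L𝒬 (𝟙 (r P ≟ᶠ v)) (#endingAt 𝒬 v) ⟩
    (Lᴾ + 𝟙 (r P ≟ᶠ v)) + (L𝒬 + #endingAt 𝒬 v)
      ≡⟨ cong₂ _+_ (edgesFrom-balance u ws v) (familyEdges-balance 𝒬 v) ⟩
    (Eᴾ + 𝟙 (ℓ P ≟ᶠ v)) + (E𝒬 + #startingAt 𝒬 v)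
      ≡⟨ interchange Eᴾ (𝟙 (ℓ P ≟ᶠ v)) E𝒬 (#startingAt 𝒬 v) ⟩
    (Eᴾ + E𝒬) + (𝟙 (ℓ P ≟ᶠ v) + #startingAt 𝒬 v)
      ≡⟨ cong (_+ (𝟙 (ℓ P ≟ᶠ v) + #startingAt 𝒬 v)) (sym (sum-map-++ _ (edges P) (familyEdges 𝒬))) ⟩
    #entering v (edges P ++ familyEdges 𝒬) + (𝟙 (ℓ P ≟ᶠ v) + #startingAt 𝒬 v)
      ∎
    where
    Lᴾ = #leaving v (edges P)
    L𝒬 = #leaving v (familyEdges 𝒬)
    Eᴾ = #entering v (edges P)
    E𝒬 = #entering v (familyEdges 𝒬)

  edgesFrom-sources : ∀ (u : Fin n) ws {e} → e ∈ edgesFrom u ws → proj₁ e ∈ u ∷ ws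
  edgesFrom-sources u (w ∷ ws) (here refl) = here refl
  edgesFrom-sources u (w ∷ ws) (there e∈)  = there (edgesFrom-sources w ws e∈)

  edgesFrom-unique : ∀ (u : Fin n) ws → Unique (u ∷ ws) → Unique (edgesFrom u ws)
  edgesFrom-unique u []       _             = []
  edgesFrom-unique u (w ∷ ws) (u≢ws ∷ ws!) =
    All.tabulate (λ e∈ uw≡e → All¬⇒¬Any u≢ws
      (subst (_∈ w ∷ ws) (cong proj₁ (sym uw≡e)) (edgesFrom-sources w ws e∈)))
    ∷ edgesFrom-unique w ws ws!

  ∈-familyEdges : ∀ {𝒬 P} {e : Edge n} → P ∈ 𝒬 → e ∈ edges P → e ∈ familyEdges 𝒬
  ∈-familyEdges P∈𝒬 e∈P = ∈-concatMap⁺ edges (lose P∈𝒬 e∈P)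

  ∑-#startingAt : ∀ (𝒬 : List (Walk n)) → ∑[ v < n ] #startingAt 𝒬 v ≡ length 𝒬
  ∑-#startingAt []      = sum-replicate-zero n
  ∑-#startingAt (P ∷ 𝒬) = begin
    ∑[ v < n ] (𝟙 (ℓ P ≟ᶠ v) + #startingAt 𝒬 v)
      ≡⟨ ∑-distrib-+ (λ v → 𝟙 (ℓ P ≟ᶠ v)) (#startingAt 𝒬) ⟩
    ∑[ v < n ] 𝟙 (ℓ P ≟ᶠ v) + ∑[ v < n ] #startingAt 𝒬 v
      ≡⟨ cong₂ _+_ (trans (sum-cong-≗ (𝟙-≟ᶠ-sym (ℓ P))) (∑-𝟙-≟ (ℓ P))) (∑-#startingAt 𝒬) ⟩
    1 + length 𝒬
      ∎

  module _ (D : Digraph n) where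
    familyEdges-adj : ∀ {𝒬} → All (IsPath D) 𝒬 → ∀ {e} → e ∈ familyEdges 𝒬 → adj D (proj₁ e) (proj₂ e) ≡ true
    familyEdges-adj paths e∈ with find (∈-concatMap⁻ edges e∈)
    ... | P , P∈𝒬 , e∈P = All.lookup (proj₂ (proj₂ (All.lookup paths P∈𝒬))) e∈P

    familyEdges-unique : ∀ {𝒬} → IsPathFamily D 𝒬 → Unique (familyEdges 𝒬)
    familyEdges-unique (paths , disjoint) =
      concat⁺ (Allₚ.map⁺ (All.map (λ (_ , distinct , _) → edgesFrom-unique _ _ distinct) paths))
              (AllPairsₚ.map⁺ (AllPairs.map (λ P#Q {e} (e∈P , e∈Q) → P#Q e e∈P e∈Q) disjoint))

    adj-─⁻ : ∀ 𝒬 {u v} → adj (D ─ 𝒬) u v ≡ true → adj D u v ≡ true × (u , v) ∉ familyEdges 𝒬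
    adj-─⁻ 𝒬 {u} {v} = ∧-not-does⁻ (adj D u v) ((u , v) ∈? familyEdges 𝒬)

    adj-─⁺ : ∀ 𝒬 {u v} → adj D u v ≡ true → (u , v) ∉ familyEdges 𝒬 → adj (D ─ 𝒬) u v ≡ true
    adj-─⁺ 𝒬 {u} {v} = ∧-not-does⁺ ((u , v) ∈? familyEdges 𝒬)

    outdeg-─ : ∀ {𝒬} → IsPathFamily D 𝒬 → ∀ v →
      outdeg D v ≡ outdeg (D ─ 𝒬) v + #leaving v (familyEdges 𝒬)
    outdeg-─ {𝒬} 𝒬-family@(paths , _) v = begin
      outdeg D v
        ≡⟨ sum-map-allFin (λ w → b2n (adj D v w)) ⟩
      ∑[ w < n ] b2n (adj D v w)
        ≡⟨ sum-cong-≗ (λ w → b2n-∧-not (adj D v w) ((v , w) ∈? familyEdges 𝒬) (familyEdges-adj paths)) ⟩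
      ∑[ w < n ] (b2n (adj (D ─ 𝒬) v w) + 𝟙 ((v , w) ∈? familyEdges 𝒬))
        ≡⟨ ∑-distrib-+ (λ w → b2n (adj (D ─ 𝒬) v w)) (λ w → 𝟙 ((v , w) ∈? familyEdges 𝒬)) ⟩
      ∑[ w < n ] b2n (adj (D ─ 𝒬) v w) + ∑[ w < n ] 𝟙 ((v , w) ∈? familyEdges 𝒬)
        ≡⟨ cong₂ _+_ (sym (sum-map-allFin (λ w → b2n (adj (D ─ 𝒬) v w))))
                     (∑-𝟙-∈-leaving v (familyEdges-unique 𝒬-family)) ⟩
      outdeg (D ─ 𝒬) v + #leaving v (familyEdges 𝒬)
        ∎

    indeg-─ : ∀ {𝒬} → IsPathFamily D 𝒬 → ∀ v →
      indeg D v ≡ indeg (D ─ 𝒬) v + #entering v (familyEdges 𝒬)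
    indeg-─ {𝒬} 𝒬-family@(paths , _) v = begin
      indeg D v
        ≡⟨ sum-map-allFin (λ w → b2n (adj D w v)) ⟩
      ∑[ w < n ] b2n (adj D w v)
        ≡⟨ sum-cong-≗ (λ w → b2n-∧-not (adj D w v) ((w , v) ∈? familyEdges 𝒬) (familyEdges-adj paths)) ⟩
      ∑[ w < n ] (b2n (adj (D ─ 𝒬) w v) + 𝟙 ((w , v) ∈? familyEdges 𝒬))
        ≡⟨ ∑-distrib-+ (λ w → b2n (adj (D ─ 𝒬) w v)) (λ w → 𝟙 ((w , v) ∈? familyEdges 𝒬)) ⟩
      ∑[ w < n ] b2n (adj (D ─ 𝒬) w v) + ∑[ w < n ] 𝟙 ((w , v) ∈? familyEdges 𝒬)
        ≡⟨ cong₂ _+_ (sym (sum-map-allFin (λ w → b2n (adj (D ─ 𝒬) w v))))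
                     (∑-𝟙-∈-entering v (familyEdges-unique 𝒬-family)) ⟩
      indeg (D ─ 𝒬) v + #entering v (familyEdges 𝒬)
        ∎

    ex⁺-─ : ∀ {𝒬} → IsPartialPathDecomposition D 𝒬 → ∀ v →
      ex⁺ D v ≡ ex⁺ (D ─ 𝒬) v + #startingAt 𝒬 v
    ex⁺-─ {𝒬} (𝒬-family , bounds) v =
      trans (cong₂ _∸_ out≡ in≡)
        (∸-+-excess (outdeg (D ─ 𝒬) v) (indeg (D ─ 𝒬) v) (familyEdges-balance 𝒬 v)
          (subst (#startingAt 𝒬 v ≤_) (cong₂ _∸_ out≡ in≡) (proj₁ (bounds v)))
          (subst (#endingAt 𝒬 v ≤_) (cong₂ _∸_ in≡ out≡) (proj₂ (bounds v))))
      where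
      out≡ = outdeg-─ 𝒬-family v
      in≡  = indeg-─ 𝒬-family v

    ex-─ : ∀ {𝒬} → IsPartialPathDecomposition D 𝒬 → ex D ≡ ex (D ─ 𝒬) + length 𝒬
    ex-─ {𝒬} 𝒬-partial = begin
      ex D                                                     ≡⟨ sum-map-allFin (ex⁺ D) ⟩
      ∑[ v < n ] ex⁺ D v                                       ≡⟨ sum-cong-≗ (ex⁺-─ 𝒬-partial) ⟩
      ∑[ v < n ] (ex⁺ (D ─ 𝒬) v + #startingAt 𝒬 v)            ≡⟨ ∑-distrib-+ (ex⁺ (D ─ 𝒬)) (#startingAt 𝒬) ⟩
      ∑[ v < n ] ex⁺ (D ─ 𝒬) v + ∑[ v < n ] #startingAt 𝒬 v  ≡⟨ cong₂ _+_ (sym (sum-map-allFin (ex⁺ (D ─ 𝒬)))) (∑-#startingAt 𝒬) ⟩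
      ex (D ─ 𝒬) + length 𝒬                                   ∎

    IsPath-─ : ∀ 𝒬 {P : Walk n} → IsPath (D ─ 𝒬) P → IsPath D P
    IsPath-─ 𝒬 (nonempty , distinct , adjacent) = nonempty , distinct , All.map (λ a → proj₁ (adj-─⁻ 𝒬 a)) adjacent

    IsPathFamily-++ : ∀ {𝒬 ℛ} → IsPathFamily D 𝒬 → IsPathFamily (D ─ 𝒬) ℛ → IsPathFamily D (𝒬 ++ ℛ)
    IsPathFamily-++ {𝒬} {ℛ} (paths𝒬 , disjoint𝒬) (pathsℛ , disjointℛ) =
      Allₚ.++⁺ paths𝒬 (All.map (IsPath-─ 𝒬) pathsℛ) , AllPairsₚ.++⁺ disjoint𝒬 disjointℛ across
      where
      across : All (λ P → All (EdgeDisjoint P) ℛ) 𝒬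
      across = All.tabulate λ P∈𝒬 → All.tabulate λ R∈ℛ e e∈P e∈R →
        proj₂ (adj-─⁻ 𝒬 (All.lookup (proj₂ (proj₂ (All.lookup pathsℛ R∈ℛ))) e∈R)) (∈-familyEdges P∈𝒬 e∈P)

    IsPathDecomposition-++ : ∀ {𝒬 ℛ} → IsPathFamily D 𝒬 → IsPathDecomposition (D ─ 𝒬) ℛ →
      IsPathDecomposition D (𝒬 ++ ℛ)
    IsPathDecomposition-++ {𝒬} {ℛ} 𝒬-family@(paths𝒬 , _) (ℛ-family , ℛ-covers) =
      IsPathFamily-++ 𝒬-family ℛ-family , λ u v → covered u v , adjacent u v
      where
      covered : ∀ u v → adj D u v ≡ true → (u , v) ∈ familyEdges (𝒬 ++ ℛ)
      covered u v uv∈D with (u , v) ∈? familyEdges 𝒬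
      ... | yes uv∈𝒬 = subst ((u , v) ∈_) (sym (concatMap-++ edges 𝒬 ℛ)) (∈-++⁺ˡ uv∈𝒬)
      ... | no  uv∉𝒬 = subst ((u , v) ∈_) (sym (concatMap-++ edges 𝒬 ℛ))
                         (∈-++⁺ʳ (familyEdges 𝒬) (proj₁ (ℛ-covers u v) (adj-─⁺ 𝒬 uv∈D uv∉𝒬)))

      adjacent : ∀ u v → (u , v) ∈ familyEdges (𝒬 ++ ℛ) → adj D u v ≡ true
      adjacent u v uv∈ with ∈-++⁻ (familyEdges 𝒬) (subst ((u , v) ∈_) (concatMap-++ edges 𝒬 ℛ) uv∈)
      ... | inj₁ uv∈𝒬 = familyEdges-adj paths𝒬 uv∈𝒬
      ... | inj₂ uv∈ℛ = proj₁ (adj-─⁻ 𝒬 (proj₂ (ℛ-covers u v) uv∈ℛ))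

proposition2p5 : ∀ {n : ℕ} (D : Digraph n) (𝒬 : List (Walk n)) →
    IsPartialPathDecomposition D 𝒬 →
    Consistent (D ─ 𝒬) →
    Σ (List (Walk n)) (λ 𝒫 → IsPerfectPathDecomposition D 𝒫 × 𝒬 ⊆ 𝒫)
proposition2p5 D 𝒬 𝒬-partial@(𝒬-family , _) (ℛ , ℛ-decomposition , ∣ℛ∣≡ex) =
  𝒬 ++ ℛ , (IsPathDecomposition-++ D 𝒬-family ℛ-decomposition , ∣𝒬++ℛ∣≡ex) , ∈-++⁺ˡ
  where
  ∣𝒬++ℛ∣≡ex : length (𝒬 ++ ℛ) ≡ ex D
  ∣𝒬++ℛ∣≡ex = begin
    length (𝒬 ++ ℛ)        ≡⟨ length-++ 𝒬 ⟩
    length 𝒬 + length ℛ    ≡⟨ cong (length 𝒬 +_) ∣ℛ∣≡ex ⟩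
    length 𝒬 + ex (D ─ 𝒬)  ≡⟨ +-comm (length 𝒬) _ ⟩
    ex (D ─ 𝒬) + length 𝒬  ≡⟨ sym (ex-─ D 𝒬-partial) ⟩
    ex D                   ∎
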